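{- Let $k$ and $\alpha$ be positive integers, let $H$ be a $(k+\alpha)$-uniform $\alpha$-intersecting hypergraph, and let $H'$ be the result of $\alpha$-shrinking $H$. If $H'$ has a vertex of degree $d$, then $H$ has more than $d^{1/\alpha}$ vertices of degree at least $d$ (degrees in $H$).
   Context: A hypergraph is $r$-uniform if every edge contains exactly $r$ vertices. It is $\alpha$-intersecting if any two distinct edges share at most $\alpha$ vertices. The degree of a vertex is the number of edges containing it. The $\alpha$-shrinking of a $(k+\alpha)$-uniform hypergraph $H$ is the $k$-uniform hypergraph $H'$ on the same vertex set obtained by deleting, from each edge of $H$, the $\alpha$ vertices of that edge having maximum degree in $H$ (ties broken arbitrarily); each edge of $H$ yields exactly one edge of $H'$. -}

module Defs where

open import Data.Nat using (ℕ; _+_; _≤_; _≤?_)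
open import Data.Fin using (Fin)
open import Data.Fin.Subset using (Subset; _∈_; _∉_; _⊆_; _∩_; ∣_∣)
open import Data.Fin.Subset.Properties using (_∈?_)
open import Data.List using (List; length; filter; lookup; allFin)
open import Data.List.Relation.Unary.All using (All)
open import Data.List.Relation.Binary.Pointwise using (Pointwise)
open import Data.Product using (_×_)
open import Relation.Binary.PropositionalEquality using (_≡_; _≢_)

Hypergraph : ℕ → Set
Hypergraph n = List (Subset n)

deg : ∀ {n} → Hypergraph n → Fin n → ℕ
deg H v = length (filter (λ e → v ∈? e) H)

Uniform : ∀ {n} → ℕ → Hypergraph n → Set
Uniform r H = All (λ e → ∣ e ∣ ≡ r) H

Intersecting : ∀ {n} → ℕ → Hypergraph n → Set
Intersecting α H = ∀ (i j : Fin (length H)) → i ≢ j → ∣ lookup H i ∩ lookup H j ∣ ≤ α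

-- e' is obtained from the edge e of H by deleting α vertices of e of maximum degree in H
-- (ties broken arbitrarily): e' ⊆ e, exactly α vertices removed, and every removed vertex
-- has H-degree at least that of every kept vertex.
ShrinkEdge : ∀ {n} → ℕ → Hypergraph n → Subset n → Subset n → Set
ShrinkEdge α H e e' =
  (e' ⊆ e) × (∣ e' ∣ + α ≡ ∣ e ∣) ×
  (∀ u v → u ∈ e → u ∉ e' → v ∈ e' → deg H v ≤ deg H u)

IsShrinking : ∀ {n} → ℕ → Hypergraph n → Hypergraph n → Set
IsShrinking α H H' = Pointwise (ShrinkEdge α H) H H'

countDegAtLeast : ∀ {n} → Hypergraph n → ℕ → ℕ
countDegAtLeast {n} H d = length (filter (λ v → d ≤? deg H v) (allFin n))

module Submission where

-- Fix a vertex v with deg H' v ≡ d.  Every edge e' of H' through v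
-- comes from an edge e of H, and the set e ─ e' of removed vertices has exactly α
-- elements, none of them v, each of H-degree at least deg H v ≥ d (removed
-- vertices have maximal degree in e).  Distinct edges e, f of H through v give
-- distinct removed sets: if e ─ e' = f ─ f' then this set together with v lies in
-- e ∩ f, which would then have more than α elements.  So the d removed sets are
-- pairwise distinct α-subsets of Y = X - v, where X is the set of vertices of
-- H-degree at least d, and therefore d ≤ ∣ Y ∣ ^ α < ∣ X ∣ ^ α.

open import Defs
open import Data.Nat using (ℕ; zero; suc; _+_; _*_; _^_; _≤_; _<_; _≤?_; z≤n; s≤s; NonZero)
open import Data.Nat.Properties
open import Data.Bool using (Bool; true; false)
open import Data.Empty using (⊥; ⊥-elim)
open import Data.Fin using (Fin) renaming (zero to fzero; suc to fsuc)
open import Data.Fin.Properties using () renaming (suc-injective to fsuc-injective)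
open import Data.Fin.Subset using (Subset; _∈_; _∉_; _⊆_; _⊂_; _∩_; _─_; _-_; ∣_∣; inside; outside)
open import Data.Fin.Subset.Properties
  using (_∈?_; x∈p∩q⁺; p─q⊆p; p⊂q⇒∣p∣<∣q∣; x∈p⇒∣p-x∣<∣p∣; x∈p∧x≢y⇒x∈p-y; drop-∷-⊆; drop-there)
open import Data.List using (List; []; _∷_; length; filter; lookup)
import Data.List as List
open import Data.List.Relation.Unary.All as All using (All; []; _∷_)
open import Data.List.Relation.Unary.AllPairs using (AllPairs; []; _∷_)
open import Data.List.Relation.Unary.Unique.Propositional using (Unique)
open import Data.List.Relation.Binary.Pointwise as Pointwise using (Pointwise; []; _∷_)
open import Data.Product using (∃; _×_; _,_; proj₁; proj₂)
open import Data.Vec using ([]; _∷_; tabulate; here; there)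
open import Data.Vec.Properties using (lookup⇒[]=; lookup∘tabulate)
open import Relation.Nullary using (¬_; yes; no; does)
open import Relation.Nullary.Decidable using (dec-true)
open import Relation.Unary using (Decidable)
open import Relation.Binary.PropositionalEquality using (_≡_; _≢_; refl; sym; trans; cong; subst; module ≡-Reasoning)

∈─⁻ : ∀ {n} {x : Fin n} (p q : Subset n) → x ∈ p ─ q → x ∈ p × x ∉ q
∈─⁻ (inside ∷ p) (outside ∷ q) here = here , λ ()
∈─⁻ {x = fzero} (outside ∷ p) (outside ∷ q) ()
∈─⁻ {x = fzero} (inside ∷ p) (inside ∷ q) ()
∈─⁻ {x = fzero} (outside ∷ p) (inside ∷ q) ()
∈─⁻ (s ∷ p) (t ∷ q) (there x∈p─q) with ∈─⁻ p q x∈p─q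
... | x∈p , x∉q = there x∈p , λ x∈t∷q → x∉q (drop-there x∈t∷q)

∣p─q∣+∣q∣≡∣p∣ : ∀ {n} (p q : Subset n) → q ⊆ p → ∣ p ─ q ∣ + ∣ q ∣ ≡ ∣ p ∣
∣p─q∣+∣q∣≡∣p∣ [] [] _ = refl
∣p─q∣+∣q∣≡∣p∣ (inside ∷ p) (inside ∷ q) q⊆p =
  trans (+-suc _ _) (cong suc (∣p─q∣+∣q∣≡∣p∣ p q (drop-∷-⊆ q⊆p)))
∣p─q∣+∣q∣≡∣p∣ (inside ∷ p) (outside ∷ q) q⊆p = cong suc (∣p─q∣+∣q∣≡∣p∣ p q (drop-∷-⊆ q⊆p))
∣p─q∣+∣q∣≡∣p∣ (outside ∷ p) (outside ∷ q) q⊆p = ∣p─q∣+∣q∣≡∣p∣ p q (drop-∷-⊆ q⊆p)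
∣p─q∣+∣q∣≡∣p∣ (outside ∷ p) (inside ∷ q) q⊆p with q⊆p here
... | ()

∣tabulate∣≡length-filter : ∀ {n m} {P : Fin m → Set} (P? : Decidable P) (f : Fin n → Fin m) →
                           ∣ tabulate (λ u → does (P? (f u))) ∣ ≡ length (filter P? (List.tabulate f))
∣tabulate∣≡length-filter {zero} P? f = refl
∣tabulate∣≡length-filter {suc n} P? f with P? (f fzero)
... | yes _ = cong suc (∣tabulate∣≡length-filter P? (λ u → f (fsuc u)))
... | no _ = ∣tabulate∣≡length-filter P? (λ u → f (fsuc u))

SizedSubset : ∀ {n} → ℕ → Subset n → Subset n → Set
SizedSubset a Y S = ∣ S ∣ ≡ a × S ⊆ Y

part : ∀ {n} → Bool → List (Subset (suc n)) → List (Subset n)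
part b [] = []
part false ((outside ∷ t) ∷ F) = t ∷ part false F
part false ((inside ∷ t) ∷ F) = part false F
part true ((outside ∷ t) ∷ F) = part true F
part true ((inside ∷ t) ∷ F) = t ∷ part true F

part-length : ∀ {n} (F : List (Subset (suc n))) → length F ≡ length (part true F) + length (part false F)
part-length [] = refl
part-length ((inside ∷ t) ∷ F) = cong suc (part-length F)
part-length ((outside ∷ t) ∷ F) = trans (cong suc (part-length F)) (sym (+-suc _ _))

part-All : ∀ {n} {P : Subset (suc n) → Set} (b : Bool) (F : List (Subset (suc n))) →
           All P F → All (λ t → P (b ∷ t)) (part b F)
part-All b [] [] = []
part-All false ((outside ∷ t) ∷ F) (p ∷ ps) = p ∷ part-All false F ps
part-All false ((inside ∷ t) ∷ F) (p ∷ ps) = part-All false F ps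
part-All true ((outside ∷ t) ∷ F) (p ∷ ps) = part-All true F ps
part-All true ((inside ∷ t) ∷ F) (p ∷ ps) = p ∷ part-All true F ps

part-Unique : ∀ {n} (b : Bool) (F : List (Subset (suc n))) → Unique F → Unique (part b F)
part-Unique b [] [] = []
part-Unique false ((outside ∷ t) ∷ F) (t≢ ∷ u) =
  All.map (λ ≢ eq → ≢ (cong (outside ∷_) eq)) (part-All false F t≢) ∷ part-Unique false F u
part-Unique false ((inside ∷ t) ∷ F) (_ ∷ u) = part-Unique false F u
part-Unique true ((outside ∷ t) ∷ F) (_ ∷ u) = part-Unique true F u
part-Unique true ((inside ∷ t) ∷ F) (t≢ ∷ u) =
  All.map (λ ≢ eq → ≢ (cong (inside ∷_) eq)) (part-All true F t≢) ∷ part-Unique true F u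

length-All-⊥ : ∀ {A : Set} (F : List A) → All (λ _ → ⊥) F → length F ≡ 0
length-All-⊥ [] [] = refl

part-false-sized : ∀ {n a c} {Y : Subset n} (F : List (Subset (suc n))) →
                   All (SizedSubset a (c ∷ Y)) F → All (SizedSubset a Y) (part false F)
part-false-sized F sized = All.map (λ (size , ⊆Y) → size , λ {x} → drop-∷-⊆ ⊆Y {x}) (part-All false F sized)

part-true-sized : ∀ {n a c} {Y : Subset n} (F : List (Subset (suc n))) →
                  All (SizedSubset (suc a) (c ∷ Y)) F → All (SizedSubset a Y) (part true F)
part-true-sized F sized = All.map (λ (size , ⊆Y) → suc-injective size , λ {x} → drop-∷-⊆ ⊆Y {x}) (part-All true F sized)

part-true-outside : ∀ {n a} {Y : Subset n} (F : List (Subset (suc n))) →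
                    All (SizedSubset a (outside ∷ Y)) F → length (part true F) ≡ 0
part-true-outside F sized = length-All-⊥ (part true F) (All.map (λ (_ , ⊆Y) → 0∉ (⊆Y here)) (part-All true F sized))
  where
  0∉ : ∀ {n} {Y : Subset n} → fzero ∈ outside ∷ Y → ⊥
  0∉ ()

part-true-empty : ∀ {n} {Y : Subset (suc n)} (F : List (Subset (suc n))) →
                  All (SizedSubset 0 Y) F → length (part true F) ≡ 0
part-true-empty F sized = length-All-⊥ (part true F) (All.map (λ { (() , _) }) (part-All true F sized))

-- A list of pairwise distinct a-element subsets of Y has at most ∣ Y ∣ ^ a members.
-- Induction on the ground set: split the family by whether it contains 0.
distinct-subsets-bound : ∀ {n} (a : ℕ) (Y : Subset n) (F : List (Subset n)) →
                         Unique F → All (SizedSubset a Y) F → length F ≤ ∣ Y ∣ ^ a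
distinct-subsets-bound zero [] [] _ _ = z≤n
distinct-subsets-bound zero [] ([] ∷ []) _ _ = ≤-refl
distinct-subsets-bound zero [] ([] ∷ [] ∷ F) ((≢ ∷ _) ∷ _) _ = ⊥-elim (≢ refl)
distinct-subsets-bound (suc a) [] [] _ _ = z≤n
distinct-subsets-bound (suc a) [] ([] ∷ F) _ ((() , _) ∷ _)
distinct-subsets-bound a (outside ∷ Y) F unique sized = begin
  length F                                      ≡⟨ part-length F ⟩
  length (part true F) + length (part false F)  ≡⟨ cong (_+ length (part false F)) (part-true-outside F sized) ⟩
  length (part false F)                         ≤⟨ distinct-subsets-bound a Y (part false F)
                                                     (part-Unique false F unique) (part-false-sized F sized) ⟩
  ∣ Y ∣ ^ a                                     ∎
  where open ≤-Reasoning
distinct-subsets-bound zero (inside ∷ Y) F unique sized = begin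
  length F                                      ≡⟨ part-length F ⟩
  length (part true F) + length (part false F)  ≡⟨ cong (_+ length (part false F)) (part-true-empty F sized) ⟩
  length (part false F)                         ≤⟨ distinct-subsets-bound zero Y (part false F)
                                                     (part-Unique false F unique) (part-false-sized F sized) ⟩
  1                                             ∎
  where open ≤-Reasoning
distinct-subsets-bound (suc a) (inside ∷ Y) F unique sized = begin
  length F                                      ≡⟨ part-length F ⟩
  length (part true F) + length (part false F)  ≤⟨ +-mono-≤
    (distinct-subsets-bound a Y (part true F) (part-Unique true F unique) (part-true-sized F sized))
    (distinct-subsets-bound (suc a) Y (part false F) (part-Unique false F unique) (part-false-sized F sized)) ⟩
  m ^ a + m * m ^ a                             ≤⟨ +-mono-≤ (^-monoˡ-≤ a (n≤1+n m)) (*-monoʳ-≤ m (^-monoˡ-≤ a (n≤1+n m))) ⟩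
  suc m ^ a + m * suc m ^ a                     ∎
  where
  open ≤-Reasoning
  m = ∣ Y ∣

All-from-lookup : ∀ {A : Set} {R : A → Set} (xs : List A) → (∀ j → R (lookup xs j)) → All R xs
All-from-lookup [] _ = []
All-from-lookup (x ∷ xs) R-at = R-at fzero ∷ All-from-lookup xs (λ j → R-at (fsuc j))

intersecting⇒pairwise : ∀ {n} (α : ℕ) (H : Hypergraph n) → Intersecting α H →
                        AllPairs (λ e f → ∣ e ∩ f ∣ ≤ α) H
intersecting⇒pairwise α [] _ = []
intersecting⇒pairwise α (e ∷ H) intersecting =
  All-from-lookup H (λ j → intersecting fzero (fsuc j) (λ ()))
  ∷ intersecting⇒pairwise α H (λ i j i≢j → intersecting (fsuc i) (fsuc j) (λ eq → i≢j (fsuc-injective eq)))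

deg-mono : ∀ {n} (v : Fin n) {H H' : Hypergraph n} → Pointwise (λ e e' → e' ⊆ e) H H' → deg H' v ≤ deg H v
deg-mono v [] = z≤n
deg-mono v {e ∷ H} {e' ∷ H'} (e'⊆e ∷ shrunk) with v ∈? e' | v ∈? e
... | yes _    | yes _    = s≤s (deg-mono v shrunk)
... | yes v∈e' | no v∉e   = ⊥-elim (v∉e (e'⊆e v∈e'))
... | no _     | yes _    = m≤n⇒m≤1+n (deg-mono v shrunk)
... | no _     | no _     = deg-mono v shrunk

module RemovedSet {n} (α : ℕ) (H : Hypergraph n) {e e' : Subset n} (shrink : ShrinkEdge α H e e') where

  removed-size : ∣ e ─ e' ∣ ≡ α
  removed-size = +-cancelʳ-≡ ∣ e' ∣ _ _ (begin
    ∣ e ─ e' ∣ + ∣ e' ∣  ≡⟨ ∣p─q∣+∣q∣≡∣p∣ e e' (proj₁ shrink) ⟩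
    ∣ e ∣               ≡⟨ sym (proj₁ (proj₂ shrink)) ⟩
    ∣ e' ∣ + α          ≡⟨ +-comm ∣ e' ∣ α ⟩
    α + ∣ e' ∣          ∎)
    where open ≡-Reasoning

  removed-heavy : ∀ {u v} → v ∈ e' → u ∈ e ─ e' → deg H v ≤ deg H u × u ≢ v
  removed-heavy {u} {v} v∈e' u∈e─e' =
    proj₂ (proj₂ shrink) u v u∈e u∉e' v∈e' , λ { refl → u∉e' v∈e' }
    where
    u∈e = proj₁ (∈─⁻ e e' u∈e─e')
    u∉e' = proj₂ (∈─⁻ e e' u∈e─e')

  -- If another edge f meets e in at most α vertices and shares with e a vertex v kept
  -- in e', then e ─ e' ⊄ f: otherwise e ─ e' ⊂ f ∩ e (v is in the latter, not the
  -- former), giving ∣ f ∩ e ∣ > α.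
  removed-not-within : ∀ {f v} → v ∈ f → v ∈ e' → ∣ f ∩ e ∣ ≤ α → ¬ (e ─ e') ⊆ f
  removed-not-within {f} {v} v∈f v∈e' ∣f∩e∣≤α removed⊆f =
    <-irrefl refl (≤-trans (subst (_< ∣ f ∩ e ∣) removed-size (p⊂q⇒∣p∣<∣q∣ removed⊂f∩e)) ∣f∩e∣≤α)
    where
    removed⊂f∩e : (e ─ e') ⊂ (f ∩ e)
    removed⊂f∩e = (λ u∈ → x∈p∩q⁺ (removed⊆f u∈ , p─q⊆p e e' u∈))
                , v , x∈p∩q⁺ (v∈f , proj₁ shrink v∈e') , (λ v∈ → proj₂ (∈─⁻ e e' v∈) v∈e')

module RemovedSets {n} (α : ℕ) (H : Hypergraph n) (v : Fin n) where

  open RemovedSet α H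

  removedAt : List (Subset n) → List (Subset n) → List (Subset n)
  removedAt (e ∷ L) (e' ∷ L') with v ∈? e'
  ... | yes _ = (e ─ e') ∷ removedAt L L'
  ... | no _  = removedAt L L'
  removedAt _ _ = []

  removedAt-length : ∀ {L L'} → Pointwise (ShrinkEdge α H) L L' → length (removedAt L L') ≡ deg L' v
  removedAt-length [] = refl
  removedAt-length {e ∷ L} {e' ∷ L'} (_ ∷ shrunk) with v ∈? e'
  ... | yes _ = cong suc (removedAt-length shrunk)
  ... | no _  = removedAt-length shrunk

  removedAt-sized : ∀ {L L'} (Y : Subset n) → (∀ {u} → deg H v ≤ deg H u → u ≢ v → u ∈ Y) →
                    Pointwise (ShrinkEdge α H) L L' → All (SizedSubset α Y) (removedAt L L')
  removedAt-sized Y heavy⊆Y [] = []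
  removedAt-sized {e ∷ L} {e' ∷ L'} Y heavy⊆Y (shrink ∷ shrunk) with v ∈? e'
  ... | yes v∈e' = (removed-size shrink , λ u∈ → let (heavy , u≢v) = removed-heavy shrink v∈e' u∈ in heavy⊆Y heavy u≢v)
                   ∷ removedAt-sized Y heavy⊆Y shrunk
  ... | no _     = removedAt-sized Y heavy⊆Y shrunk

  removedAt-not-within : ∀ {f L L'} → v ∈ f → All (λ e → ∣ f ∩ e ∣ ≤ α) L →
                         Pointwise (ShrinkEdge α H) L L' → All (λ S → ¬ S ⊆ f) (removedAt L L')
  removedAt-not-within v∈f [] [] = []
  removedAt-not-within {f} {e ∷ L} {e' ∷ L'} v∈f (∣f∩e∣≤α ∷ small) (shrink ∷ shrunk) with v ∈? e'
  ... | yes v∈e' = removed-not-within shrink v∈f v∈e' ∣f∩e∣≤α ∷ removedAt-not-within v∈f small shrunk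
  ... | no _     = removedAt-not-within v∈f small shrunk

  -- In an α-intersecting hypergraph the removed sets are pairwise distinct, since each
  -- lies in its own edge but in no other edge through v.
  removedAt-unique : ∀ {L L'} → AllPairs (λ e f → ∣ e ∩ f ∣ ≤ α) L →
                     Pointwise (ShrinkEdge α H) L L' → Unique (removedAt L L')
  removedAt-unique [] [] = []
  removedAt-unique {e ∷ L} {e' ∷ L'} (small ∷ pairwise) (shrink ∷ shrunk) with v ∈? e'
  ... | yes v∈e' = All.map (λ not-within eq → not-within (subst (_⊆ e) eq (p─q⊆p e e')))
                           (removedAt-not-within (proj₁ shrink v∈e') small shrunk)
                   ∷ removedAt-unique pairwise shrunk
  ... | no _     = removedAt-unique pairwise shrunk

degAtLeast : ∀ {n} → Hypergraph n → ℕ → Subset n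
degAtLeast H d = tabulate (λ u → does (d ≤? deg H u))

∈degAtLeast : ∀ {n} (H : Hypergraph n) {d u} → d ≤ deg H u → u ∈ degAtLeast H d
∈degAtLeast H {d} {u} d≤deg =
  lookup⇒[]= u (degAtLeast H d) (trans (lookup∘tabulate _ u) (dec-true (d ≤? deg H u) d≤deg))

∣degAtLeast∣ : ∀ {n} (H : Hypergraph n) d → ∣ degAtLeast H d ∣ ≡ countDegAtLeast H d
∣degAtLeast∣ H d = ∣tabulate∣≡length-filter (λ u → d ≤? deg H u) (λ u → u)

lemma1 : ∀ (k α n : ℕ) → NonZero k → NonZero α →
         (H H' : Hypergraph n) →
         Uniform (k + α) H → Intersecting α H → IsShrinking α H H' →
         (d : ℕ) → (∃ λ (v : Fin n) → deg H' v ≡ d) →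
         d < countDegAtLeast H d ^ α
lemma1 k α n _ α≢0 H H' _ intersecting shrinking d (v , deg≡d) = begin-strict
  d                             ≡⟨ sym (trans (removedAt-length shrinking) deg≡d) ⟩
  length (removedAt H H')       ≤⟨ distinct-subsets-bound α Y (removedAt H H')
                                     (removedAt-unique (intersecting⇒pairwise α H intersecting) shrinking)
                                     (removedAt-sized Y heavy⊆Y shrinking) ⟩
  ∣ Y ∣ ^ α                     <⟨ ^-monoˡ-< α {{α≢0}} (x∈p⇒∣p-x∣<∣p∣ (∈degAtLeast H d≤deg-v)) ⟩
  ∣ X ∣ ^ α                     ≡⟨ cong (_^ α) (∣degAtLeast∣ H d) ⟩
  countDegAtLeast H d ^ α       ∎
  where
  open ≤-Reasoning
  open RemovedSets α H v
  X Y : Subset n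
  X = degAtLeast H d
  Y = X - v
  -- Shrinking does not increase degrees, so v has H-degree at least d.
  d≤deg-v : d ≤ deg H v
  d≤deg-v = subst (_≤ deg H v) deg≡d (deg-mono v (Pointwise.map proj₁ shrinking))
  heavy⊆Y : ∀ {u} → deg H v ≤ deg H u → u ≢ v → u ∈ Y
  heavy⊆Y deg-v≤deg-u u≢v = x∈p∧x≢y⇒x∈p-y (∈degAtLeast H (≤-trans d≤deg-v deg-v≤deg-u)) u≢v
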